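{- Let $\mathcal{N}=(P,T,F,\mathit{In},\Upsilon)$ be a safe Petri net with transits and $\varphi$ a Flow-LTL formula with $n\ge1$ flow subformulas $\mathbb{A}\,\psi_1,\dots,\mathbb{A}\,\psi_n$. Let $\varphi^{\mathit{MC}}$ be the LTL formula obtained from $\varphi$ by the parallel construction described in the context. Then the size of $\varphi^{\mathit{MC}}$ is in $\mathcal{O}(|\mathcal{N}|^{3n}\cdot|\varphi|+|\varphi|)$, where $|\mathcal{N}|$ is the size of $\mathcal{N}$ (its number of places and transitions) and $|\varphi|$ the size of $\varphi$.
   Context: A safe Petri net with transits $\mathcal{N}=(P,T,F,\mathit{In},\Upsilon)$ consists of finite sets of places $P$ and transitions $T$, a flow relation $F\subseteq(P\times T)\cup(T\times P)$, an initial marking $\mathit{In}\subseteq P$ with all reachable markings safe (at most one token per place), and for each $t\in T$ a transit relation $\Upsilon(t)\subseteq({}^\bullet t\cup\{\triangleright\})\times t^\bullet$ ($\triangleright$ a start symbol). Flow-LTL is LTL over places and transitions as atomic propositions with an additional flow operator $\mathbb{A}$; a flow subformula has the form $\mathbb{A}\,\psi$ with $\psi$ LTL; the rest of the formula is the run part. Net construction $\mathcal{N}^{\mathit{MC}}$: places $P\cup\bigcup_{i=1}^n(\{\iota_i\}\cup\{[p]_i\mid p\in P\})$, initial marking $\mathit{In}\cup\{\iota_1,\dots,\iota_n\}$; for every $t\in T$ and $\mathfrak c=(c_1,\dots,c_n)\in(\Upsilon(t)\cup\{\emptyset\})^n$ one transition $t_{\mathfrak c}$ with label $\lambda(t_{\mathfrak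 c})=t$, having the arcs of $t$ on $P$, and for each $i$: if $c_i=(\triangleright,p_i)$ arcs $\iota_i\to t_{\mathfrak c}\to[p_i]_i$; if $c_i=(x_i,p_i)$, $x_i\in P$, arcs $[x_i]_i\to t_{\mathfrak c}\to[p_i]_i$; if $c_i=\emptyset$, inhibitor arcs from $[p]_i$ to $t_{\mathfrak c}$ for all $p\in{}^\bullet t$. Let $T^{\mathit{MC}}$ be the set of all these transitions, $T^{\mathit{MC}}_i$ those having an ordinary arc to or from some $[p]_i$, $O_i=T^{\mathit{MC}}\setminus T^{\mathit{MC}}_i$, and $M_i(t)=T^{\mathit{MC}}_i\cap\{t'\mid\lambda(t')=t\}$. Formula construction $\varphi^{\mathit{MC}}$: inside the $i$-th flow subformula $\psi_i$, replace each place $p$ by $[p]_i$, each transition $t$ by $(\bigvee_{t_o\in O_i}t_o)\,\mathcal{U}\,(\bigvee_{t_m\in M_i(t)}t_m)$, and each $\bigcirc\phi$ (innermost first) by $((\bigvee_{t\in O_i}t)\,\mathcal{U}\,((\bigvee_{t\in T^{\mathit{MC}}_i}t)\wedge\bigcirc\phi))\vee(\Box\neg(\bigvee_{t\in T^{\mathit{MC}}_i}t)\wedge\phi)$, yielding $\psi_i'$. In the run part, places and next operators are unchanged and each transition $t$ is replaced by $\bigvee_{t'\in T^{\mathit{MC}},\lambda(t')=t}t'$. Finally each flow subformula $\mathbb{A}\,\psi_i$ is replaced by $\iota_i\,\mathcal{W}\,(\neg\iota_i\wedge\psi_i')$ ($\mathcal{W}$ weak until). -}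

module Defs where

open import Data.Bool using (_≟_; Bool; true; false; _∧_; _∨_; not; if_then_else_)
open import Data.Nat using (ℕ; zero; suc; _+_; _∸_; _≤_; _<?_)
open import Data.Fin using (Fin; fromℕ<)
open import Data.Fin.Properties using () renaming (_≟_ to _≟F_)
open import Data.List using (List; []; _∷_; _++_; map; concatMap; filter; length; foldr; deduplicateᵇ)
open import Data.List.Base using (allFin)
open import Data.Vec using (Vec; lookup) renaming ([] to []v; _∷_ to _∷v_)
open import Data.Vec.Properties using () renaming (≡-dec to ≡-decV)
open import Data.Maybe using (Maybe; just; nothing)
open import Data.Maybe.Properties using () renaming (≡-dec to ≡-decM)
open import Data.Product using (_×_; _,_; proj₁; proj₂)
open import Data.Product.Properties using () renaming (≡-dec to ≡-dec×)
open import Data.Sum using (_⊎_; inj₁; inj₂)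
open import Relation.Nullary using (Dec; yes; no; does)
open import Relation.Binary.PropositionalEquality using (_≡_; refl)
open import Relation.Binary.Definitions using (DecidableEquality)

-- Petri nets with transits: places Fin np, transitions Fin nt.
-- Flow relation F given by pre (p,t) ∈ F and post (t,p) ∈ F.
-- Transit relation Υ(t) ⊆ (•t ∪ {▷}) × t•, with ▷ = nothing.

record PNwT (np nt : ℕ) : Set where
  field
    pre  : Fin nt → Fin np → Bool
    post : Fin nt → Fin np → Bool
    In   : Fin np → Bool
    Υ    : Fin nt → Maybe (Fin np) → Fin np → Bool
open PNwT public

b2n : Bool → ℕ
b2n true  = 1
b2n false = 0

Marking : ℕ → Set
Marking np = Fin np → ℕ

module _ {np nt : ℕ} (N : PNwT np nt) where
  Enabled : Marking np → Fin nt → Set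
  Enabled M t = ∀ p → pre N t p ≡ true → 1 ≤ M p

  fire : Marking np → Fin nt → Marking np
  fire M t p = (M p ∸ b2n (pre N t p)) + b2n (post N t p)

  data Reachable : Marking np → Set where
    initial : Reachable (λ p → b2n (In N p))
    step    : ∀ {M} t → Reachable M → Enabled M t → Reachable (fire M t)

  Safe : Set
  Safe = ∀ M → Reachable M → ∀ p → M p ≤ 1

  TransitsWF : Set
  TransitsWF = ∀ t x p → Υ N t x p ≡ true →
                 (post N t p ≡ true) ×
                 ((y : Fin np) → x ≡ just y → pre N t y ≡ true)

netSize : ∀ {np nt} → PNwT np nt → ℕ
netSize {np} {nt} _ = np + nt

data LTL (A : Set) : Set where
  tt   : LTL A
  atom : A → LTL A
  ¬ₗ_  : LTL A → LTL A
  _∧ₗ_ : LTL A → LTL A → LTL A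
  ○_   : LTL A → LTL A
  _𝒰_  : LTL A → LTL A → LTL A

module _ {A : Set} where
  ffₗ : LTL A
  ffₗ = ¬ₗ tt

  _∨ₗ_ : LTL A → LTL A → LTL A
  a ∨ₗ b = ¬ₗ ((¬ₗ a) ∧ₗ (¬ₗ b))

  _⇒ₗ_ : LTL A → LTL A → LTL A
  a ⇒ₗ b = (¬ₗ a) ∨ₗ b

  □_ : LTL A → LTL A
  □ a = ¬ₗ (tt 𝒰 (¬ₗ a))

  _𝒲_ : LTL A → LTL A → LTL A
  a 𝒲 b = (a 𝒰 b) ∨ₗ (□ a)

  bigOr : List (LTL A) → LTL A
  bigOr = foldr _∨ₗ_ ffₗ

  sizeₗ : LTL A → ℕ
  sizeₗ tt = 1
  sizeₗ (atom _) = 1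
  sizeₗ (¬ₗ a) = suc (sizeₗ a)
  sizeₗ (a ∧ₗ b) = suc (sizeₗ a + sizeₗ b)
  sizeₗ (○ a) = suc (sizeₗ a)
  sizeₗ (a 𝒰 b) = suc (sizeₗ a + sizeₗ b)

  subformulas : LTL A → List (LTL A)
  subformulas tt = tt ∷ []
  subformulas (atom x) = atom x ∷ []
  subformulas (¬ₗ a) = (¬ₗ a) ∷ subformulas a
  subformulas (a ∧ₗ b) = (a ∧ₗ b) ∷ subformulas a ++ subformulas b
  subformulas (○ a) = (○ a) ∷ subformulas a
  subformulas (a 𝒰 b) = (a 𝒰 b) ∷ subformulas a ++ subformulas b

  eqₗ : DecidableEquality A → LTL A → LTL A → Bool
  eqₗ d tt tt = true
  eqₗ d (atom x) (atom y) = does (d x y)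
  eqₗ d (¬ₗ a) (¬ₗ b) = eqₗ d a b
  eqₗ d (a ∧ₗ b) (c ∧ₗ e) = eqₗ d a c ∧ eqₗ d b e
  eqₗ d (○ a) (○ b) = eqₗ d a b
  eqₗ d (a 𝒰 b) (c 𝒰 e) = eqₗ d a c ∧ eqₗ d b e
  eqₗ d _ _ = false

  dagSize : DecidableEquality A → LTL A → ℕ
  dagSize d φ = length (deduplicateᵇ (eqₗ d) (subformulas φ))

data FlowLTL (A : Set) : Set where
  ltl  : LTL A → FlowLTL A
  _∧f_ : FlowLTL A → FlowLTL A → FlowLTL A
  _∨f_ : FlowLTL A → FlowLTL A → FlowLTL A
  _⇒f_ : LTL A → FlowLTL A → FlowLTL A
  𝔸    : LTL A → FlowLTL A

module _ {A : Set} where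
  #flows : FlowLTL A → ℕ
  #flows (ltl _) = 0
  #flows (a ∧f b) = #flows a + #flows b
  #flows (a ∨f b) = #flows a + #flows b
  #flows (_ ⇒f b) = #flows b
  #flows (𝔸 _) = 1

  sizeF : FlowLTL A → ℕ
  sizeF (ltl ψ) = sizeₗ ψ
  sizeF (a ∧f b) = suc (sizeF a + sizeF b)
  sizeF (a ∨f b) = suc (sizeF a + sizeF b)
  sizeF (ψ ⇒f b) = suc (sizeₗ ψ + sizeF b)
  sizeF (𝔸 ψ) = suc (sizeₗ ψ)

data MCPlace (np n : ℕ) : Set where
  orig : Fin np → MCPlace np n
  ι    : Fin n → MCPlace np n
  copy : Fin n → Fin np → MCPlace np n

_≟MCP_ : ∀ {np n} → DecidableEquality (MCPlace np n)
orig p ≟MCP orig q with p ≟F q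
... | yes refl = yes refl
... | no ne = no λ { refl → ne refl }
orig _ ≟MCP ι _ = no λ ()
orig _ ≟MCP copy _ _ = no λ ()
ι _ ≟MCP orig _ = no λ ()
ι i ≟MCP ι j with i ≟F j
... | yes refl = yes refl
... | no ne = no λ { refl → ne refl }
ι _ ≟MCP copy _ _ = no λ ()
copy _ _ ≟MCP orig _ = no λ ()
copy _ _ ≟MCP ι _ = no λ ()
copy i p ≟MCP copy j q with i ≟F j | p ≟F q
... | yes refl | yes refl = yes refl
... | no ne | _ = no λ { refl → ne refl }
... | yes _ | no ne = no λ { refl → ne refl }

-- a component c_i ∈ Υ(t) ∪ {∅}:  nothing = ∅,  just (x , p) with x = nothing meaning ▷
Choice : ℕ → Set
Choice np = Maybe (Maybe (Fin np) × Fin np)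

MCTrans : ℕ → ℕ → ℕ → Set
MCTrans np nt n = Fin nt × Vec (Choice np) n

_≟MCT_ : ∀ {np nt n} → DecidableEquality (MCTrans np nt n)
_≟MCT_ = ≡-dec× _≟F_ (≡-decV (≡-decM (≡-dec× (≡-decM _≟F_) _≟F_)))

MCAtom : ℕ → ℕ → ℕ → Set
MCAtom np nt n = MCPlace np n ⊎ MCTrans np nt n

_≟MCA_ : ∀ {np nt n} → DecidableEquality (MCAtom np nt n)
inj₁ p ≟MCA inj₁ q with p ≟MCP q
... | yes refl = yes refl
... | no ne = no λ { refl → ne refl }
inj₁ _ ≟MCA inj₂ _ = no λ ()
inj₂ _ ≟MCA inj₁ _ = no λ ()
inj₂ s ≟MCA inj₂ u with s ≟MCT u
... | yes refl = yes refl
... | no ne = no λ { refl → ne refl }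

allVecs : {X : Set} → List X → (n : ℕ) → List (Vec X n)
allVecs xs zero = []v ∷ []
allVecs xs (suc n) = concatMap (λ x → map (x ∷v_) (allVecs xs n)) xs

module MC {np nt : ℕ} (N : PNwT np nt) (n : ℕ) where

  choices : Fin nt → List (Choice np)
  choices t = nothing ∷
    concatMap (λ x → concatMap (λ p →
        if Υ N t x p then just (x , p) ∷ [] else []) (allFin np))
      (nothing ∷ map just (allFin np))

  TMC : List (MCTrans np nt n)
  TMC = concatMap (λ t → map (t ,_) (allVecs (choices t) n)) (allFin nt)

  label : MCTrans np nt n → Fin nt
  label = proj₁

  preMC : MCTrans np nt n → List (MCPlace np n)
  preMC (t , c) =
    concatMap (λ p → if pre N t p then orig p ∷ [] else []) (allFin np) ++
    concatMap (λ i → f i (lookup c i)) (allFin n)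
    where
    f : Fin n → Choice np → List (MCPlace np n)
    f i nothing = []
    f i (just (nothing , _)) = ι i ∷ []
    f i (just (just x , _)) = copy i x ∷ []

  postMC : MCTrans np nt n → List (MCPlace np n)
  postMC (t , c) =
    concatMap (λ p → if post N t p then orig p ∷ [] else []) (allFin np) ++
    concatMap (λ i → f i (lookup c i)) (allFin n)
    where
    f : Fin n → Choice np → List (MCPlace np n)
    f i nothing = []
    f i (just (_ , p)) = copy i p ∷ []

  inhibMC : MCTrans np nt n → List (MCPlace np n)
  inhibMC (t , c) = concatMap (λ i → f i (lookup c i)) (allFin n)
    where
    f : Fin n → Choice np → List (MCPlace np n)
    f i nothing = concatMap (λ p → if pre N t p then copy i p ∷ [] else []) (allFin np)
    f i (just _) = []

  isCopyOf : Fin n → MCPlace np n → Bool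
  isCopyOf i (copy j _) = does (i ≟F j)
  isCopyOf i _ = false

  anyB : {X : Set} → (X → Bool) → List X → Bool
  anyB f = foldr (λ x b → f x ∨ b) false

  inTi : Fin n → MCTrans np nt n → Bool
  inTi i t' = anyB (isCopyOf i) (preMC t' ++ postMC t')

  Ti : Fin n → List (MCTrans np nt n)
  Ti i = filter (λ t' → inTi i t' ≟ true) TMC

  Oi : Fin n → List (MCTrans np nt n)
  Oi i = filter (λ t' → inTi i t' ≟ false) TMC

  Mi : Fin n → Fin nt → List (MCTrans np nt n)
  Mi i t = filter (λ t' → label t' ≟F t) (Ti i)

  Atom' = MCAtom np nt n

  disj : List (MCTrans np nt n) → LTL Atom'
  disj ts = bigOr (map (λ t' → atom (inj₂ t')) ts)

  flowTr : Fin n → LTL (Fin np ⊎ Fin nt) → LTL Atom'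
  flowTr i tt = tt
  flowTr i (atom (inj₁ p)) = atom (inj₁ (copy i p))
  flowTr i (atom (inj₂ t)) = disj (Oi i) 𝒰 disj (Mi i t)
  flowTr i (¬ₗ a) = ¬ₗ flowTr i a
  flowTr i (a ∧ₗ b) = flowTr i a ∧ₗ flowTr i b
  flowTr i (○ a) =
    (disj (Oi i) 𝒰 (disj (Ti i) ∧ₗ (○ φ))) ∨ₗ ((□ (¬ₗ disj (Ti i))) ∧ₗ φ)
    where φ = flowTr i a
  flowTr i (a 𝒰 b) = flowTr i a 𝒰 flowTr i b

  runTr : LTL (Fin np ⊎ Fin nt) → LTL Atom'
  runTr tt = tt
  runTr (atom (inj₁ p)) = atom (inj₁ (orig p))
  runTr (atom (inj₂ t)) = disj (filter (λ t' → label t' ≟F t) TMC)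
  runTr (¬ₗ a) = ¬ₗ runTr a
  runTr (a ∧ₗ b) = runTr a ∧ₗ runTr b
  runTr (○ a) = ○ runTr a
  runTr (a 𝒰 b) = runTr a 𝒰 runTr b

  -- flow subformulas are numbered 0,1,… from left to right;
  -- k = number of flow subformulas already passed
  -- (the fallback `tt` is never used when n = #flows φ)
  tr : ℕ → FlowLTL (Fin np ⊎ Fin nt) → LTL Atom'
  tr k (ltl ψ) = runTr ψ
  tr k (a ∧f b) = tr k a ∧ₗ tr (k + #flows a) b
  tr k (a ∨f b) = tr k a ∨ₗ tr (k + #flows a) b
  tr k (ψ ⇒f b) = runTr ψ ⇒ₗ tr k b
  tr k (𝔸 ψ) with k <? n
  ... | yes k<n = atom (inj₁ (ι i)) 𝒲 ((¬ₗ atom (inj₁ (ι i))) ∧ₗ flowTr i ψ)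
    where i = fromℕ< k<n
  ... | no _ = tt

φMC : ∀ {np nt} → PNwT np nt → (φ : FlowLTL (Fin np ⊎ Fin nt)) →
      LTL (MCAtom np nt (#flows φ))
φMC N φ = MC.tr N (#flows φ) 0 φ

sizeφMC : ∀ {np nt} → PNwT np nt → FlowLTL (Fin np ⊎ Fin nt) → ℕ
sizeφMC N φ = dagSize _≟MCA_ (φMC N φ)

{-# OPTIONS --safe #-}
module Submission where

-- Size is counted with sharing, so it suffices to exhibit a list of O(|φ| · (|T^MC| + 1))
-- formulas containing every subformula of φ^MC. Each clause of the translation fills a
-- template of at most 18 nodes with the translated children and with disjunctions over
-- subsets of T^MC, which have O(|T^MC|) subformulas. The ○-template uses its child twice,
-- but the child's subformulas are listed only once, so every node of φ contributes
-- O(|T^MC|) formulas; and |T^MC| ≤ |T| · (1 + |P| + |P|²)ⁿ ≤ |N|^{3n}.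

open import Defs
open import Data.Bool using (T; T?; true; false; if_then_else_)
open import Data.Bool.Properties using (T-∧)
open import Data.Empty using (⊥-elim)
open import Data.Fin using (Fin; zero; suc; fromℕ<; _≟_)
open import Data.Fin.Properties using (injective⇒≤)
open import Data.List using (List; []; _∷_; _++_; length; lookup; map; filter; concatMap; allFin; deduplicate)
open import Data.List.Properties using (length-++; length-map; length-filter; length-tabulate)
open import Data.List.Membership.Propositional.Properties using (∈-lookup; ∈-++⁻; ∈-deduplicate⁻)
open import Data.List.Membership.Setoid.Properties using (index-injective)
open import Data.List.Relation.Binary.Subset.Propositional using (_⊆_)
open import Data.List.Relation.Binary.Subset.Propositional.Properties
  using (⊆-refl; ⊆-trans; xs⊆x∷xs; ∷⁺ʳ; xs⊆xs++ys; xs⊆ys++xs; ++⁺ˡ; map⁺)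
import Data.List.Relation.Unary.All as All
open import Data.List.Relation.Unary.All.Properties using (all-filter)
open import Data.List.Relation.Unary.Any using (here)
open import Data.List.Relation.Unary.Unique.Propositional using (Unique; []; _∷_)
import Data.List.Relation.Unary.Unique.Propositional.Properties as Unique
open import Data.Maybe using (Maybe; nothing; just)
open import Data.Nat using (ℕ; zero; suc; _+_; _*_; _^_; _≤_; _≤ᵇ_; _<?_; z≤n; s≤s; >-nonZero)
open import Data.Nat.Properties
  using ( ≤-refl; ≤-reflexive; ≤-trans; ≤ᵇ⇒≤; m≤m+n; m≤n+m; +-comm; +-assoc; *-suc; *-identityʳ
        ; *-distribʳ-+; *-distribˡ-+; +-mono-≤; +-monoˡ-≤; +-monoʳ-≤; *-mono-≤; *-monoˡ-≤
        ; ^-monoˡ-≤; ^-monoʳ-≤; ^-*-assoc; module ≤-Reasoning)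
open import Data.Nat.Tactic.RingSolver using (solve-∀)
open import Data.Product using (∃-syntax; _,_)
open import Data.Sum using (_⊎_; inj₁; inj₂)
open import Data.Vec using (Vec; []; _∷_; [_]) renaming (lookup to _!_)
open import Function using (_∘_; Equivalence)
open import Relation.Binary using (Rel; Decidable; Reflexive; DecidableEquality)
open import Relation.Binary.PropositionalEquality
  using (_≡_; refl; sym; trans; cong; cong₂; subst; setoid)
open import Relation.Nullary using (¬?; yes; no)

module _ {A : Set} where

  unique⇒lookup-injective : ∀ {xs : List A} → Unique xs →
                            ∀ {i j} → lookup xs i ≡ lookup xs j → i ≡ j
  unique⇒lookup-injective (_ ∷ _) {zero} {zero} _ = refl
  unique⇒lookup-injective (x∉xs ∷ _) {zero} {suc j} eq = ⊥-elim (All.lookup x∉xs (∈-lookup j) eq)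
  unique⇒lookup-injective (x∉xs ∷ _) {suc i} {zero} eq = ⊥-elim (All.lookup x∉xs (∈-lookup i) (sym eq))
  unique⇒lookup-injective (_ ∷ u) {suc i} {suc j} eq = cong suc (unique⇒lookup-injective u eq)

  unique∧⊆⇒length≤ : ∀ {xs ys : List A} → Unique xs → xs ⊆ ys → length xs ≤ length ys
  unique∧⊆⇒length≤ u xs⊆ys = injective⇒≤ λ eq →
    unique⇒lookup-injective u (index-injective (setoid A) (xs⊆ys (∈-lookup _)) (xs⊆ys (∈-lookup _)) eq)

  deduplicate-unique : ∀ {r} {R : Rel A r} (R? : Decidable R) → Reflexive R →
                       ∀ xs → Unique (deduplicate R? xs)
  deduplicate-unique R? R-refl [] = []
  deduplicate-unique {R = R} R? R-refl (x ∷ xs) =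
    All.map (λ ¬Rxy x≡y → ¬Rxy (subst (R x) x≡y R-refl)) (all-filter (¬? ∘ R? x) (deduplicate R? xs))
    ∷ Unique.filter⁺ (¬? ∘ R? x) (deduplicate-unique R? R-refl xs)

  ++-⊆ : ∀ {xs ys zs : List A} → xs ⊆ zs → ys ⊆ zs → xs ++ ys ⊆ zs
  ++-⊆ {xs} xs⊆zs ys⊆zs x∈ with ∈-++⁻ xs x∈
  ... | inj₁ x∈xs = xs⊆zs x∈xs
  ... | inj₂ x∈ys = ys⊆zs x∈ys

  length-if-≤ : ∀ b (x : A) → length (if b then x ∷ [] else []) ≤ 1
  length-if-≤ true _ = ≤-refl
  length-if-≤ false _ = z≤n

  length-concatMap-≤ : ∀ {B : Set} (f : A → List B) {m} xs →
                       (∀ x → length (f x) ≤ m) → length (concatMap f xs) ≤ length xs * m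
  length-concatMap-≤ f [] _ = z≤n
  length-concatMap-≤ f (x ∷ xs) f≤m =
    ≤-trans (≤-reflexive (length-++ (f x))) (+-mono-≤ (f≤m x) (length-concatMap-≤ f xs f≤m))

  length-allVecs-≤ : (xs : List A) → ∀ n → length (allVecs xs n) ≤ length xs ^ n
  length-allVecs-≤ xs zero = ≤-refl
  length-allVecs-≤ xs (suc n) = length-concatMap-≤ _ xs λ x →
    ≤-trans (≤-reflexive (length-map (x ∷_) (allVecs xs n))) (length-allVecs-≤ xs n)

length-allFin : ∀ n → length (allFin n) ≡ n
length-allFin n = length-tabulate (λ i → i)

module _ {A : Set} where

  length-subformulas : (φ : LTL A) → length (subformulas φ) ≡ sizeₗ φ
  length-subformulas tt = refl
  length-subformulas (atom _) = refl
  length-subformulas (¬ₗ φ) = cong suc (length-subformulas φ)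
  length-subformulas (○ φ) = cong suc (length-subformulas φ)
  length-subformulas (φ ∧ₗ ψ) = cong suc (trans (length-++ (subformulas φ))
                                                (cong₂ _+_ (length-subformulas φ) (length-subformulas ψ)))
  length-subformulas (φ 𝒰 ψ) = cong suc (trans (length-++ (subformulas φ))
                                               (cong₂ _+_ (length-subformulas φ) (length-subformulas ψ)))

  eqₗ-refl : (d : DecidableEquality A) (φ : LTL A) → T (eqₗ d φ φ)
  eqₗ-refl d tt = _
  eqₗ-refl d (atom x) with d x x
  ... | yes _ = _
  ... | no x≢x = x≢x refl
  eqₗ-refl d (¬ₗ φ) = eqₗ-refl d φ
  eqₗ-refl d (○ φ) = eqₗ-refl d φ
  eqₗ-refl d (φ ∧ₗ ψ) = Equivalence.from T-∧ (eqₗ-refl d φ , eqₗ-refl d ψ)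
  eqₗ-refl d (φ 𝒰 ψ) = Equivalence.from T-∧ (eqₗ-refl d φ , eqₗ-refl d ψ)

  dagSize-≤ : (d : DecidableEquality A) {φ : LTL A} {S : List (LTL A)} →
              subformulas φ ⊆ S → dagSize d φ ≤ length S
  dagSize-≤ d {φ} φ⊆S = unique∧⊆⇒length≤
    (deduplicate-unique R? (λ {ψ} → eqₗ-refl d ψ) (subformulas φ))
    (φ⊆S ∘ ∈-deduplicate⁻ R? (subformulas φ))
    where R? = λ ψ χ → T? (eqₗ d ψ χ)

infix 25 _⟨_⟩

_⟨_⟩ : ∀ {A k} → LTL (Fin k) → Vec (LTL A) k → LTL A
tt ⟨ σ ⟩ = tt
atom v ⟨ σ ⟩ = σ ! v
(¬ₗ τ) ⟨ σ ⟩ = ¬ₗ (τ ⟨ σ ⟩)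
(τ ∧ₗ υ) ⟨ σ ⟩ = τ ⟨ σ ⟩ ∧ₗ υ ⟨ σ ⟩
(○ τ) ⟨ σ ⟩ = ○ (τ ⟨ σ ⟩)
(τ 𝒰 υ) ⟨ σ ⟩ = τ ⟨ σ ⟩ 𝒰 υ ⟨ σ ⟩

x₀ : ∀ {k} → LTL (Fin (suc k))
x₀ = atom zero

x₁ : ∀ {k} → LTL (Fin (suc (suc k)))
x₁ = atom (suc zero)

x₂ : ∀ {k} → LTL (Fin (suc (suc (suc k))))
x₂ = atom (suc (suc zero))

module _ {A : Set} {k : ℕ} {σ : Vec (LTL A) k} {S : List (LTL A)} where

  private
    merge : ∀ {xs ys} (τs υs : List (LTL (Fin k))) →
            xs ⊆ map (_⟨ σ ⟩) τs ++ S → ys ⊆ map (_⟨ σ ⟩) υs ++ S →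
            xs ++ ys ⊆ map (_⟨ σ ⟩) (τs ++ υs) ++ S
    merge τs υs xs⊆ ys⊆ = ++-⊆ (⊆-trans xs⊆ (grow (xs⊆xs++ys τs υs))) (⊆-trans ys⊆ (grow (xs⊆ys++xs υs τs)))
      where
      grow : ∀ {τs′ υs′} → τs′ ⊆ υs′ → map (_⟨ σ ⟩) τs′ ++ S ⊆ map (_⟨ σ ⟩) υs′ ++ S
      grow = ++⁺ˡ S ∘ map⁺ _

  subformulas-⟨⟩ : (τ : LTL (Fin k)) → (∀ v → subformulas (σ ! v) ⊆ S) →
                   subformulas (τ ⟨ σ ⟩) ⊆ map (_⟨ σ ⟩) (subformulas τ) ++ S
  subformulas-⟨⟩ tt _ (here refl) = here refl
  subformulas-⟨⟩ (atom v) σ⊆S = xs⊆x∷xs _ _ ∘ σ⊆S v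
  subformulas-⟨⟩ (¬ₗ τ) σ⊆S = ∷⁺ʳ _ (subformulas-⟨⟩ τ σ⊆S)
  subformulas-⟨⟩ (○ τ) σ⊆S = ∷⁺ʳ _ (subformulas-⟨⟩ τ σ⊆S)
  subformulas-⟨⟩ (τ ∧ₗ υ) σ⊆S =
    ∷⁺ʳ _ (merge (subformulas τ) (subformulas υ) (subformulas-⟨⟩ τ σ⊆S) (subformulas-⟨⟩ υ σ⊆S))
  subformulas-⟨⟩ (τ 𝒰 υ) σ⊆S =
    ∷⁺ʳ _ (merge (subformulas τ) (subformulas υ) (subformulas-⟨⟩ τ σ⊆S) (subformulas-⟨⟩ υ σ⊆S))

record Cover {A : Set} {k : ℕ} (m : ℕ) (σ : Vec (LTL A) k) : Set where
  constructor cover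
  field
    carrier  : List (LTL A)
    complete : ∀ v → subformulas (σ ! v) ⊆ carrier
    bounded  : length carrier ≤ m

module _ {A : Set} where

  cover-subformulas : (φ : LTL A) → Cover (sizeₗ φ) [ φ ]
  cover-subformulas φ = cover (subformulas φ) (λ { zero → ⊆-refl }) (≤-reflexive (length-subformulas φ))

  cover-mono : ∀ {k m m′} {σ : Vec (LTL A) k} → m ≤ m′ → Cover m σ → Cover m′ σ
  cover-mono m≤m′ (cover S complete bounded) = cover S complete (≤-trans bounded m≤m′)

  infixr 5 _∷ᶜ_

  _∷ᶜ_ : ∀ {k m m′ φ} {σ : Vec (LTL A) k} → Cover m [ φ ] → Cover m′ σ → Cover (m + m′) (φ ∷ σ)
  cover S complete bounded ∷ᶜ cover S′ complete′ bounded′ =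
    cover (S ++ S′)
          (λ { zero → ⊆-trans (complete zero) (xs⊆xs++ys S S′)
             ; (suc v) → ⊆-trans (complete′ v) (xs⊆ys++xs S′ S) })
          (≤-trans (≤-reflexive (length-++ S)) (+-mono-≤ bounded bounded′))

  cover-⟨⟩ : ∀ {k m} {σ : Vec (LTL A) k} (τ : LTL (Fin k)) → Cover m σ → Cover (sizeₗ τ + m) [ τ ⟨ σ ⟩ ]
  cover-⟨⟩ {σ = σ} τ (cover S complete bounded) =
    cover (map (_⟨ σ ⟩) (subformulas τ) ++ S) (λ { zero → subformulas-⟨⟩ τ complete }) (begin
      length (map (_⟨ σ ⟩) (subformulas τ) ++ S)        ≡⟨ length-++ (map (_⟨ σ ⟩) (subformulas τ)) ⟩
      length (map (_⟨ σ ⟩) (subformulas τ)) + length S  ≡⟨ cong (_+ length S) (length-map _ (subformulas τ)) ⟩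
      length (subformulas τ) + length S                 ≡⟨ cong (_+ length S) (length-subformulas τ) ⟩
      sizeₗ τ + length S                                ≤⟨ +-monoʳ-≤ (sizeₗ τ) bounded ⟩
      sizeₗ τ + _                                       ∎)
    where open ≤-Reasoning

  dagSize-≤-cover : (d : DecidableEquality A) {φ : LTL A} {m : ℕ} → Cover m [ φ ] → dagSize d φ ≤ m
  dagSize-≤-cover d (cover S complete bounded) = ≤-trans (dagSize-≤ d (complete zero)) bounded

module _ {c B : ℕ} (c≤B : c ≤ B) where

  leaf-≤ : ∀ x → c ≤ suc x * B
  leaf-≤ x = ≤-trans c≤B (m≤m+n B (x * B))

  node₁-≤ : ∀ x → c + x * B ≤ suc x * B
  node₁-≤ x = +-monoˡ-≤ (x * B) c≤B

  node₂-≤ : ∀ x y → c + (x * B + y * B) ≤ suc (x + y) * B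
  node₂-≤ x y = +-mono-≤ c≤B (≤-reflexive (sym (*-distribʳ-+ B x y)))

module Translation {np nt : ℕ} (N : PNwT np nt) (n : ℕ) where
  open MC N n

  -- 18 is the size of the largest template, the one for ○;
  -- D bounds the size of a disjunction over transitions of N^MC.
  K D B : ℕ
  K = length TMC
  D = K * 5 + 2
  B = 18 + (D + D)

  ≤B : ∀ c → T (c ≤ᵇ 18) → c ≤ B
  ≤B c c≤18 = ≤-trans (≤ᵇ⇒≤ c 18 c≤18) (m≤m+n 18 (D + D))

  sizeₗ-disj : ∀ ts → sizeₗ (disj ts) ≡ length ts * 5 + 2
  sizeₗ-disj [] = refl
  sizeₗ-disj (_ ∷ ts) = cong (5 +_) (sizeₗ-disj ts)

  cover-disj : ∀ ts → length ts ≤ K → Cover D [ disj ts ]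
  cover-disj ts ts≤K =
    cover-mono (≤-trans (≤-reflexive (sizeₗ-disj ts)) (+-monoˡ-≤ 2 (*-monoˡ-≤ 5 ts≤K)))
               (cover-subformulas (disj ts))

  cover-Oi : ∀ i → Cover D [ disj (Oi i) ]
  cover-Oi i = cover-disj (Oi i) (length-filter _ TMC)

  cover-Ti : ∀ i → Cover D [ disj (Ti i) ]
  cover-Ti i = cover-disj (Ti i) (length-filter _ TMC)

  cover-Mi : ∀ i t → Cover D [ disj (Mi i t) ]
  cover-Mi i t = cover-disj (Mi i t) (≤-trans (length-filter _ (Ti i)) (length-filter _ TMC))

  cover-labelled : ∀ t → Cover D [ runTr (atom (inj₂ t)) ]
  cover-labelled t = cover-disj (filter (λ t′ → label t′ ≟ t) TMC) (length-filter _ TMC)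

  -- Every clause of flowTr, runTr and tr is, up to definitional unfolding, a template
  -- instantiated with the translated children.
  cover-flowTr : ∀ i ψ → Cover (sizeₗ ψ * B) [ flowTr i ψ ]
  cover-flowTr i tt = cover-mono (leaf-≤ (≤B 1 _) 0) (cover-subformulas tt)
  cover-flowTr i (atom (inj₁ p)) = cover-mono (leaf-≤ (≤B 1 _) 0) (cover-subformulas _)
  cover-flowTr i (atom (inj₂ t)) =
    cover-mono (leaf-≤ (+-monoˡ-≤ (D + D) (≤ᵇ⇒≤ 3 18 _)) 0)
               (cover-⟨⟩ (x₀ 𝒰 x₁) (cover-Oi i ∷ᶜ cover-Mi i t))
  cover-flowTr i (¬ₗ ψ) =
    cover-mono (node₁-≤ (≤B 2 _) (sizeₗ ψ)) (cover-⟨⟩ (¬ₗ x₀) (cover-flowTr i ψ))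
  cover-flowTr i (ψ ∧ₗ χ) =
    cover-mono (node₂-≤ (≤B 3 _) (sizeₗ ψ) (sizeₗ χ))
               (cover-⟨⟩ (x₀ ∧ₗ x₁) (cover-flowTr i ψ ∷ᶜ cover-flowTr i χ))
  cover-flowTr i (ψ 𝒰 χ) =
    cover-mono (node₂-≤ (≤B 3 _) (sizeₗ ψ) (sizeₗ χ))
               (cover-⟨⟩ (x₀ 𝒰 x₁) (cover-flowTr i ψ ∷ᶜ cover-flowTr i χ))
  cover-flowTr i (○ ψ) =
    cover-mono (≤-reflexive (cong (18 +_) (sym (+-assoc D D (sizeₗ ψ * B)))))
               (cover-⟨⟩ ((x₀ 𝒰 (x₁ ∧ₗ (○ x₂))) ∨ₗ ((□ (¬ₗ x₁)) ∧ₗ x₂))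
                         (cover-Oi i ∷ᶜ cover-Ti i ∷ᶜ cover-flowTr i ψ))

  cover-runTr : ∀ ψ → Cover (sizeₗ ψ * B) [ runTr ψ ]
  cover-runTr tt = cover-mono (leaf-≤ (≤B 1 _) 0) (cover-subformulas tt)
  cover-runTr (atom (inj₁ p)) = cover-mono (leaf-≤ (≤B 1 _) 0) (cover-subformulas _)
  cover-runTr (atom (inj₂ t)) =
    cover-mono (leaf-≤ (≤-trans (m≤m+n D D) (m≤n+m (D + D) 18)) 0) (cover-labelled t)
  cover-runTr (¬ₗ ψ) = cover-mono (node₁-≤ (≤B 2 _) (sizeₗ ψ)) (cover-⟨⟩ (¬ₗ x₀) (cover-runTr ψ))
  cover-runTr (○ ψ) = cover-mono (node₁-≤ (≤B 2 _) (sizeₗ ψ)) (cover-⟨⟩ (○ x₀) (cover-runTr ψ))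
  cover-runTr (ψ ∧ₗ χ) =
    cover-mono (node₂-≤ (≤B 3 _) (sizeₗ ψ) (sizeₗ χ))
               (cover-⟨⟩ (x₀ ∧ₗ x₁) (cover-runTr ψ ∷ᶜ cover-runTr χ))
  cover-runTr (ψ 𝒰 χ) =
    cover-mono (node₂-≤ (≤B 3 _) (sizeₗ ψ) (sizeₗ χ))
               (cover-⟨⟩ (x₀ 𝒰 x₁) (cover-runTr ψ ∷ᶜ cover-runTr χ))

  cover-tr : ∀ k φ → Cover (sizeF φ * B) [ tr k φ ]
  cover-tr k (ltl ψ) = cover-runTr ψ
  cover-tr k (φ ∧f χ) =
    cover-mono (node₂-≤ (≤B 3 _) (sizeF φ) (sizeF χ))
               (cover-⟨⟩ (x₀ ∧ₗ x₁) (cover-tr k φ ∷ᶜ cover-tr (k + #flows φ) χ))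
  cover-tr k (φ ∨f χ) =
    cover-mono (node₂-≤ (≤B 6 _) (sizeF φ) (sizeF χ))
               (cover-⟨⟩ (x₀ ∨ₗ x₁) (cover-tr k φ ∷ᶜ cover-tr (k + #flows φ) χ))
  cover-tr k (ψ ⇒f χ) =
    cover-mono (node₂-≤ (≤B 7 _) (sizeₗ ψ) (sizeF χ))
               (cover-⟨⟩ (x₀ ⇒ₗ x₁) (cover-runTr ψ ∷ᶜ cover-tr k χ))
  cover-tr k (𝔸 ψ) with k <? n
  ... | yes k<n = cover-mono (node₁-≤ {c = 16} (≤B 16 _) (sizeₗ ψ))
                             (cover-⟨⟩ (x₀ 𝒲 ((¬ₗ x₀) ∧ₗ x₁))
                                       (cover-subformulas (atom (inj₁ (ι i))) ∷ᶜ cover-flowTr i ψ))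
    where i = fromℕ< k<n
  ... | no _ = cover-mono (leaf-≤ (≤B 1 _) (sizeₗ ψ)) (cover-subformulas tt)

  length-choices-≤ : ∀ t → length (choices t) ≤ suc (suc np * np)
  length-choices-≤ t = s≤s (begin
    length (concatMap transits (nothing ∷ map just (allFin np)))
      ≤⟨ length-concatMap-≤ transits (nothing ∷ map just (allFin np)) transits-≤ ⟩
    length (nothing ∷ map just (allFin np)) * np
      ≡⟨ cong (λ l → suc l * np) (trans (length-map just (allFin np)) (length-allFin np)) ⟩
    suc np * np ∎)
    where
    open ≤-Reasoning
    transits : Maybe (Fin np) → List (Choice np)
    transits x = concatMap (λ p → if Υ N t x p then just (x , p) ∷ [] else []) (allFin np)
    transits-≤ : ∀ x → length (transits x) ≤ np
    transits-≤ x = ≤-trans (length-concatMap-≤ _ (allFin np) (λ p → length-if-≤ (Υ N t x p) _))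
                           (≤-reflexive (trans (*-identityʳ _) (length-allFin np)))

  length-TMC-≤ : length TMC ≤ nt * suc (suc np * np) ^ n
  length-TMC-≤ = begin
    length TMC                                   ≤⟨ length-concatMap-≤ _ (allFin nt) vectors-≤ ⟩
    length (allFin nt) * suc (suc np * np) ^ n   ≡⟨ cong (_* _) (length-allFin nt) ⟩
    nt * suc (suc np * np) ^ n                   ∎
    where
    open ≤-Reasoning
    vectors-≤ : ∀ t → length (map (t ,_) (allVecs (choices t) n)) ≤ suc (suc np * np) ^ n
    vectors-≤ t = begin
      length (map (t ,_) (allVecs (choices t) n)) ≡⟨ length-map _ (allVecs (choices t) n) ⟩
      length (allVecs (choices t) n)              ≤⟨ length-allVecs-≤ (choices t) n ⟩
      length (choices t) ^ n                      ≤⟨ ^-monoˡ-≤ n (length-choices-≤ t) ⟩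
      suc (suc np * np) ^ n                       ∎

  s*B≤22*[M*s+s] : ∀ s {M} → K ≤ M → s * B ≤ 22 * (M * s + s)
  s*B≤22*[M*s+s] s {M} K≤M = begin
    s * B                   ≡⟨ expand s K ⟩
    10 * (K * s) + 22 * s   ≤⟨ +-monoˡ-≤ (22 * s) (*-mono-≤ (≤ᵇ⇒≤ 10 22 _) (*-monoˡ-≤ s K≤M)) ⟩
    22 * (M * s) + 22 * s   ≡⟨ sym (*-distribˡ-+ 22 (M * s) s) ⟩
    22 * (M * s + s)        ∎
    where
    open ≤-Reasoning
    expand : ∀ s K → s * (18 + ((K * 5 + 2) + (K * 5 + 2))) ≡ 10 * (K * s) + 22 * s
    expand = solve-∀

1+[1+m]*m≤[m+n]^2 : ∀ m n → 1 ≤ n → suc (suc m * m) ≤ (m + n) ^ 2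
1+[1+m]*m≤[m+n]^2 m n 1≤n = begin
  suc (suc m * m)        ≤⟨ +-monoˡ-≤ (suc m * m) (s≤s (z≤n {m})) ⟩
  suc m + suc m * m      ≡⟨ sym (*-suc (suc m) m) ⟩
  suc m * suc m          ≤⟨ *-mono-≤ 1+m≤m+n 1+m≤m+n ⟩
  (m + n) * (m + n)      ≡⟨ cong ((m + n) *_) (sym (*-identityʳ (m + n))) ⟩
  (m + n) ^ 2            ∎
  where
  open ≤-Reasoning
  1+m≤m+n : suc m ≤ m + n
  1+m≤m+n = ≤-trans (≤-reflexive (+-comm 1 m)) (+-monoʳ-≤ m 1≤n)

n*[1+[1+m]*m]^k≤[m+n]^[3*k] : ∀ m n k → 1 ≤ k → n * suc (suc m * m) ^ k ≤ (m + n) ^ (3 * k)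
n*[1+[1+m]*m]^k≤[m+n]^[3*k] m zero k _ = z≤n
n*[1+[1+m]*m]^k≤[m+n]^[3*k] m n@(suc _) k 1≤k = begin
  n * suc (suc m * m) ^ k       ≤⟨ *-mono-≤ (m≤n+m n m) (^-monoˡ-≤ k (1+[1+m]*m≤[m+n]^2 m n (s≤s z≤n))) ⟩
  (m + n) * ((m + n) ^ 2) ^ k   ≡⟨ cong ((m + n) *_) (^-*-assoc (m + n) 2 k) ⟩
  (m + n) ^ suc (2 * k)         ≤⟨ ^-monoʳ-≤ (m + n) {{>-nonZero 1≤m+n}} (+-monoˡ-≤ (2 * k) 1≤k) ⟩
  (m + n) ^ (3 * k)             ∎
  where
  open ≤-Reasoning
  1≤m+n : 1 ≤ m + n
  1≤m+n = ≤-trans (s≤s z≤n) (m≤n+m n m)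

sizeφMC-≤ : ∀ {np nt} (N : PNwT np nt) φ → 1 ≤ #flows φ →
            sizeφMC N φ ≤ 22 * (netSize N ^ (3 * #flows φ) * sizeF φ + sizeF φ)
sizeφMC-≤ {np} {nt} N φ 1≤n = begin
  sizeφMC N φ  ≤⟨ dagSize-≤-cover _≟MCA_ (cover-tr 0 φ) ⟩
  sizeF φ * B  ≤⟨ s*B≤22*[M*s+s] (sizeF φ) (≤-trans length-TMC-≤ (n*[1+[1+m]*m]^k≤[m+n]^[3*k] np nt n 1≤n)) ⟩
  22 * (netSize N ^ (3 * n) * sizeF φ + sizeF φ) ∎
  where
  n = #flows φ
  open ≤-Reasoning
  open Translation N n

lemma2 : ∃[ C ] (∀ {np nt : ℕ} (N : PNwT np nt) → Safe N → TransitsWF N →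
    (φ : FlowLTL (Fin np ⊎ Fin nt)) → 1 ≤ #flows φ →
    sizeφMC N φ ≤ C * (netSize N ^ (3 * #flows φ) * sizeF φ + sizeF φ))
lemma2 = 22 , λ N _ _ → sizeφMC-≤ N
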